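{- For every $\Sigma$-sentence $\phi$ of $\mathcal{L}_{BT}$: if $\mathfrak{D}\models\phi$, then $D\vdash\phi$.
   Context: Bit strings are elements of $\{\mathbf{0},\mathbf{1}\}^*$; $\varepsilon$ is the empty string. The language $\mathcal{L}_{BT}$ has constant symbols $e,0,1$, binary function symbol $\circ$ (also written as juxtaposition), and binary relation symbol $\preceq$. The structure $\mathfrak{D}$ has universe $\{\mathbf{0},\mathbf{1}\}^*$, interprets $e,0,1$ as $\varepsilon,\mathbf{0},\mathbf{1}$, $\circ$ as concatenation, and $\preceq$ as the prefix relation ($\alpha\preceq\beta$ iff $\alpha\gamma=\beta$ for some $\gamma$). $(\exists x\preceq t)\phi$ abbreviates $\exists x[x\preceq t\wedge\phi]$, $(\forall x\preceq t)\phi$ abbreviates $\forall x[x\preceq t\to\phi]$. $\Sigma$-formulas: $s\preceq t$, $\neg s\preceq t$, $s=t$, $\neg s=t$ (terms $s,t$) are $\Sigma$-formulas; they are closed under $\wedge,\vee$, and under $(\exists x\preceq t)$, $(\forall x\preceq t)$ and $\exists x$ where $x$ does not occur in $t$. The theory $D$ has the axioms: (1) $\forall x[x=ex\wedge x=xe]$; (2) $\forall xyz[(xy)z=x(yz)]$; (3) $\forall xy[x\neq y\to(x0\neq y0\wedge x1\neq y1)]$; (4) $\forall xy[x0\neq y1]$; (5) $\forall x[x\preceq e\leftrightarrow x=e]$; (6) $\forall xy[x\preceq y0\leftrightarrow(x=y0\vee x\preceq y)]$; (7) $\forall xy[x\preceq y1\leftrightarrow(x=y1\vee x\preceq y)]$.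 -}

module Defs where

open import Data.Nat using (ℕ; zero; suc)
open import Data.Fin using (Fin; zero; suc)
open import Data.Bool using (Bool; true; false)
open import Data.List using (List; []; _∷_; _++_; map)
open import Data.List.Membership.Propositional using (_∈_)
open import Data.Product using (Σ; _×_; _,_)
open import Data.Sum using (_⊎_)
open import Data.Empty using (⊥)
open import Relation.Binary.PropositionalEquality using (_≡_)

infixl 7 _∘ₜ_
data Term (n : ℕ) : Set where
  var   : Fin n → Term n
  e     : Term n
  c0    : Term n
  c1    : Term n
  _∘ₜ_  : Term n → Term n → Term n

infix  6 _≼_ _≐_
infixr 5 _∧'_
infixr 4 _∨'_
infixr 3 _⇒_
data Formula (n : ℕ) : Set where
  _≼_  : Term n → Term n → Formula n
  _≐_  : Term n → Term n → Formula n
  ⊥'   : Formula n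
  _⇒_  : Formula n → Formula n → Formula n
  _∧'_ : Formula n → Formula n → Formula n
  _∨'_ : Formula n → Formula n → Formula n
  ∀'   : Formula (suc n) → Formula n
  ∃'   : Formula (suc n) → Formula n

¬' : ∀ {n} → Formula n → Formula n
¬' φ = φ ⇒ ⊥'

_⇔_ : ∀ {n} → Formula n → Formula n → Formula n
φ ⇔ ψ = (φ ⇒ ψ) ∧' (ψ ⇒ φ)

Sentence : Set
Sentence = Formula 0

Ren : ℕ → ℕ → Set
Ren n m = Fin n → Fin m

extR : ∀ {n m} → Ren n m → Ren (suc n) (suc m)
extR ρ zero    = zero
extR ρ (suc i) = suc (ρ i)

renT : ∀ {n m} → Ren n m → Term n → Term m
renT ρ (var i)  = var (ρ i)
renT ρ e        = e
renT ρ c0       = c0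
renT ρ c1       = c1
renT ρ (s ∘ₜ t) = renT ρ s ∘ₜ renT ρ t

renF : ∀ {n m} → Ren n m → Formula n → Formula m
renF ρ (s ≼ t)  = renT ρ s ≼ renT ρ t
renF ρ (s ≐ t)  = renT ρ s ≐ renT ρ t
renF ρ ⊥'       = ⊥'
renF ρ (φ ⇒ ψ)  = renF ρ φ ⇒ renF ρ ψ
renF ρ (φ ∧' ψ) = renF ρ φ ∧' renF ρ ψ
renF ρ (φ ∨' ψ) = renF ρ φ ∨' renF ρ ψ
renF ρ (∀' φ)   = ∀' (renF (extR ρ) φ)
renF ρ (∃' φ)   = ∃' (renF (extR ρ) φ)

wkT : ∀ {n} → Term n → Term (suc n)
wkT = renT suc

wkF : ∀ {n} → Formula n → Formula (suc n)
wkF = renF suc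

embed : ∀ {n} → Sentence → Formula n
embed = renF (λ ())

Sub : ℕ → ℕ → Set
Sub n m = Fin n → Term m

extS : ∀ {n m} → Sub n m → Sub (suc n) (suc m)
extS σ zero    = var zero
extS σ (suc i) = wkT (σ i)

subT : ∀ {n m} → Sub n m → Term n → Term m
subT σ (var i)  = σ i
subT σ e        = e
subT σ c0       = c0
subT σ c1       = c1
subT σ (s ∘ₜ t) = subT σ s ∘ₜ subT σ t

subF : ∀ {n m} → Sub n m → Formula n → Formula m
subF σ (s ≼ t)  = subT σ s ≼ subT σ t
subF σ (s ≐ t)  = subT σ s ≐ subT σ t
subF σ ⊥'       = ⊥'
subF σ (φ ⇒ ψ)  = subF σ φ ⇒ subF σ ψ
subF σ (φ ∧' ψ) = subF σ φ ∧' subF σ ψ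
subF σ (φ ∨' ψ) = subF σ φ ∨' subF σ ψ
subF σ (∀' φ)   = ∀' (subF (extS σ) φ)
subF σ (∃' φ)   = ∃' (subF (extS σ) φ)

_[_] : ∀ {n} → Formula (suc n) → Term n → Formula n
φ [ t ] = subF σ φ
  where
  σ : Sub _ _
  σ zero    = t
  σ (suc i) = var i

∃≼ : ∀ {n} → Term n → Formula (suc n) → Formula n
∃≼ t φ = ∃' ((var zero ≼ wkT t) ∧' φ)

∀≼ : ∀ {n} → Term n → Formula (suc n) → Formula n
∀≼ t φ = ∀' ((var zero ≼ wkT t) ⇒ φ)

data IsΣ {n : ℕ} : Formula n → Set where
  σ≼   : ∀ s t → IsΣ (s ≼ t)
  σ¬≼  : ∀ s t → IsΣ (¬' (s ≼ t))
  σ≐   : ∀ s t → IsΣ (s ≐ t)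
  σ¬≐  : ∀ s t → IsΣ (¬' (s ≐ t))
  σ∧   : ∀ {φ ψ} → IsΣ φ → IsΣ ψ → IsΣ (φ ∧' ψ)
  σ∨   : ∀ {φ ψ} → IsΣ φ → IsΣ ψ → IsΣ (φ ∨' ψ)
  σ∃≼  : ∀ t {φ} → IsΣ {suc n} φ → IsΣ (∃≼ t φ)
  σ∀≼  : ∀ t {φ} → IsΣ {suc n} φ → IsΣ (∀≼ t φ)
  σ∃   : ∀ {φ} → IsΣ {suc n} φ → IsΣ (∃' φ)

BitString : Set
BitString = List Bool

_≼𝔇_ : BitString → BitString → Set
α ≼𝔇 β = Σ BitString (λ γ → α ++ γ ≡ β)

Env : ℕ → Set
Env n = Fin n → BitString

_∷ᵉ_ : ∀ {n} → BitString → Env n → Env (suc n)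
(a ∷ᵉ ρ) zero    = a
(a ∷ᵉ ρ) (suc i) = ρ i

⟦_⟧ₜ : ∀ {n} → Term n → Env n → BitString
⟦ var i ⟧ₜ  ρ = ρ i
⟦ e ⟧ₜ      ρ = []
⟦ c0 ⟧ₜ     ρ = false ∷ []
⟦ c1 ⟧ₜ     ρ = true ∷ []
⟦ s ∘ₜ t ⟧ₜ ρ = ⟦ s ⟧ₜ ρ ++ ⟦ t ⟧ₜ ρ

⟦_⟧ : ∀ {n} → Formula n → Env n → Set
⟦ s ≼ t ⟧  ρ = ⟦ s ⟧ₜ ρ ≼𝔇 ⟦ t ⟧ₜ ρ
⟦ s ≐ t ⟧  ρ = ⟦ s ⟧ₜ ρ ≡ ⟦ t ⟧ₜ ρ
⟦ ⊥' ⟧     ρ = ⊥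
⟦ φ ⇒ ψ ⟧  ρ = ⟦ φ ⟧ ρ → ⟦ ψ ⟧ ρ
⟦ φ ∧' ψ ⟧ ρ = ⟦ φ ⟧ ρ × ⟦ ψ ⟧ ρ
⟦ φ ∨' ψ ⟧ ρ = ⟦ φ ⟧ ρ ⊎ ⟦ ψ ⟧ ρ
⟦ ∀' φ ⟧   ρ = (a : BitString) → ⟦ φ ⟧ (a ∷ᵉ ρ)
⟦ ∃' φ ⟧   ρ = Σ BitString (λ a → ⟦ φ ⟧ (a ∷ᵉ ρ))

𝔇⊨_ : Sentence → Set
𝔇⊨ φ = ⟦ φ ⟧ (λ ())

infix 2 _⊢[_]_
data _⊢[_]_ {n : ℕ} (Γ : List (Formula n)) (T : Sentence → Set) : Formula n → Set where
  hyp   : ∀ {φ} → φ ∈ Γ → Γ ⊢[ T ] φ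
  axT   : ∀ {ψ} → T ψ → Γ ⊢[ T ] embed ψ
  ⊥E    : ∀ {φ} → Γ ⊢[ T ] ⊥' → Γ ⊢[ T ] φ
  raa   : ∀ {φ} → (¬' φ ∷ Γ) ⊢[ T ] ⊥' → Γ ⊢[ T ] φ
  ⇒I    : ∀ {φ ψ} → (φ ∷ Γ) ⊢[ T ] ψ → Γ ⊢[ T ] φ ⇒ ψ
  ⇒E    : ∀ {φ ψ} → Γ ⊢[ T ] φ ⇒ ψ → Γ ⊢[ T ] φ → Γ ⊢[ T ] ψ
  ∧I    : ∀ {φ ψ} → Γ ⊢[ T ] φ → Γ ⊢[ T ] ψ → Γ ⊢[ T ] φ ∧' ψ
  ∧E₁   : ∀ {φ ψ} → Γ ⊢[ T ] φ ∧' ψ → Γ ⊢[ T ] φ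
  ∧E₂   : ∀ {φ ψ} → Γ ⊢[ T ] φ ∧' ψ → Γ ⊢[ T ] ψ
  ∨I₁   : ∀ {φ ψ} → Γ ⊢[ T ] φ → Γ ⊢[ T ] φ ∨' ψ
  ∨I₂   : ∀ {φ ψ} → Γ ⊢[ T ] ψ → Γ ⊢[ T ] φ ∨' ψ
  ∨E    : ∀ {φ ψ χ} → Γ ⊢[ T ] φ ∨' ψ → (φ ∷ Γ) ⊢[ T ] χ → (ψ ∷ Γ) ⊢[ T ] χ
          → Γ ⊢[ T ] χ
  ∀I    : ∀ {φ} → map wkF Γ ⊢[ T ] φ → Γ ⊢[ T ] ∀' φ
  ∀E    : ∀ {φ} → Γ ⊢[ T ] ∀' φ → (t : Term n) → Γ ⊢[ T ] φ [ t ]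
  ∃I    : ∀ {φ} (t : Term n) → Γ ⊢[ T ] φ [ t ] → Γ ⊢[ T ] ∃' φ
  ∃E    : ∀ {φ ψ} → Γ ⊢[ T ] ∃' φ → (φ ∷ map wkF Γ) ⊢[ T ] wkF ψ → Γ ⊢[ T ] ψ
  ≐refl : ∀ {t} → Γ ⊢[ T ] t ≐ t
  ≐subst : ∀ {s t} (φ : Formula (suc n)) → Γ ⊢[ T ] s ≐ t → Γ ⊢[ T ] φ [ s ]
           → Γ ⊢[ T ] φ [ t ]

private
  x₁ : Term 1
  x₁ = var zero
  -- in ∀x∀y: x = var 1, y = var 0
  x₂ y₂ : Term 2
  x₂ = var (suc zero)
  y₂ = var zero
  -- in ∀x∀y∀z: x = var 2, y = var 1, z = var 0
  x₃ y₃ z₃ : Term 3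
  x₃ = var (suc (suc zero))
  y₃ = var (suc zero)
  z₃ = var zero

data DAxiom : Sentence → Set where
  d1 : DAxiom (∀' ((x₁ ≐ e ∘ₜ x₁) ∧' (x₁ ≐ x₁ ∘ₜ e)))
  d2 : DAxiom (∀' (∀' (∀' ((x₃ ∘ₜ y₃) ∘ₜ z₃ ≐ x₃ ∘ₜ (y₃ ∘ₜ z₃)))))
  d3 : DAxiom (∀' (∀' (¬' (x₂ ≐ y₂) ⇒
                 (¬' (x₂ ∘ₜ c0 ≐ y₂ ∘ₜ c0) ∧' ¬' (x₂ ∘ₜ c1 ≐ y₂ ∘ₜ c1)))))
  d4 : DAxiom (∀' (∀' (¬' (x₂ ∘ₜ c0 ≐ y₂ ∘ₜ c1))))
  d5 : DAxiom (∀' ((x₁ ≼ e) ⇔ (x₁ ≐ e)))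
  d6 : DAxiom (∀' (∀' ((x₂ ≼ y₂ ∘ₜ c0) ⇔ ((x₂ ≐ y₂ ∘ₜ c0) ∨' (x₂ ≼ y₂)))))
  d7 : DAxiom (∀' (∀' ((x₂ ≼ y₂ ∘ₜ c1) ⇔ ((x₂ ≐ y₂ ∘ₜ c1) ∨' (x₂ ≼ y₂)))))

D⊢_ : Sentence → Set
D⊢ φ = [] ⊢[ DAxiom ] φ

-- Name each bit string b₁⋯bₙ by its numeral, the term e b₁ ⋯ bₙ. D proves every true equation,
-- inequation, prefix and non-prefix statement between numerals (by induction from the right end,
-- using axioms (3)-(7)), and proves every term equal to the numeral of its value. By axioms (5)-(7),
-- x ⪯ num b implies the disjunction of x = num a over the prefixes a of b, which reduces a bounded
-- universal quantifier to finitely many instances. A true Σ-formula is then proved by induction on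
-- its structure, with its free variables replaced by the numerals of their values and numerals as
-- witnesses for existential quantifiers.
module Submission where

open import Data.Bool using (Bool; true; false)
open import Data.Empty using (⊥-elim)
open import Data.Fin using (zero; suc)
open import Data.List using (List; []; _∷_; _++_; _∷ʳ_; foldl; map)
open import Data.List.Properties using (++-assoc; ++-identityʳ; ++-conicalˡ; foldl-∷ʳ; ∷ʳ-injectiveˡ)
open import Data.List.Relation.Binary.Subset.Propositional using (_⊆_)
open import Data.List.Relation.Binary.Subset.Propositional.Properties using (∷⁺ʳ; map⁺; xs⊆x∷xs)
open import Data.List.Relation.Unary.Any using (here)
open import Data.List.Reverse using (Reverse; []; _∶_∶ʳ_; reverseView)
open import Data.Nat using (ℕ; suc)
open import Data.Product using (_,_)
open import Data.Sum using (_⊎_; inj₁; inj₂)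
open import Function using (_∘_)
open import Relation.Nullary using (¬_)
open import Relation.Binary.PropositionalEquality hiding ([_])

open import Defs

variable
  k m n : ℕ
  s s′ t t′ u : Term n
  φ ψ : Formula n
  Γ : List (Formula n)
  a b : BitString
  x : Bool

infixr 5 _∷ₛ_
_∷ₛ_ : Term m → Sub n m → Sub (suc n) m
(u ∷ₛ σ) zero    = u
(u ∷ₛ σ) (suc i) = σ i

extS-cong : {σ τ : Sub n m} → σ ≗ τ → extS σ ≗ extS τ
extS-cong σ≗τ zero    = refl
extS-cong σ≗τ (suc i) = cong wkT (σ≗τ i)

subT-cong : {σ τ : Sub n m} → σ ≗ τ → subT σ ≗ subT τ
subT-cong σ≗τ (var i)  = σ≗τ i
subT-cong σ≗τ e        = refl
subT-cong σ≗τ c0       = refl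
subT-cong σ≗τ c1       = refl
subT-cong σ≗τ (s ∘ₜ t) = cong₂ _∘ₜ_ (subT-cong σ≗τ s) (subT-cong σ≗τ t)

subF-cong : {σ τ : Sub n m} → σ ≗ τ → subF σ ≗ subF τ
subF-cong σ≗τ (s ≼ t)  = cong₂ _≼_ (subT-cong σ≗τ s) (subT-cong σ≗τ t)
subF-cong σ≗τ (s ≐ t)  = cong₂ _≐_ (subT-cong σ≗τ s) (subT-cong σ≗τ t)
subF-cong σ≗τ ⊥'       = refl
subF-cong σ≗τ (φ ⇒ ψ)  = cong₂ _⇒_ (subF-cong σ≗τ φ) (subF-cong σ≗τ ψ)
subF-cong σ≗τ (φ ∧' ψ) = cong₂ _∧'_ (subF-cong σ≗τ φ) (subF-cong σ≗τ ψ)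
subF-cong σ≗τ (φ ∨' ψ) = cong₂ _∨'_ (subF-cong σ≗τ φ) (subF-cong σ≗τ ψ)
subF-cong σ≗τ (∀' φ)   = cong ∀' (subF-cong (extS-cong σ≗τ) φ)
subF-cong σ≗τ (∃' φ)   = cong ∃' (subF-cong (extS-cong σ≗τ) φ)

subT-renT : (ρ : Ren n m) (σ : Sub m k) → ∀ t → subT σ (renT ρ t) ≡ subT (σ ∘ ρ) t
subT-renT ρ σ (var i)  = refl
subT-renT ρ σ e        = refl
subT-renT ρ σ c0       = refl
subT-renT ρ σ c1       = refl
subT-renT ρ σ (s ∘ₜ t) = cong₂ _∘ₜ_ (subT-renT ρ σ s) (subT-renT ρ σ t)

renT-subT : (σ : Sub n m) (ρ : Ren m k) → ∀ t → renT ρ (subT σ t) ≡ subT (renT ρ ∘ σ) t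
renT-subT σ ρ (var i)  = refl
renT-subT σ ρ e        = refl
renT-subT σ ρ c0       = refl
renT-subT σ ρ c1       = refl
renT-subT σ ρ (s ∘ₜ t) = cong₂ _∘ₜ_ (renT-subT σ ρ s) (renT-subT σ ρ t)

subT-subT : (σ : Sub n m) (τ : Sub m k) → ∀ t → subT τ (subT σ t) ≡ subT (subT τ ∘ σ) t
subT-subT σ τ (var i)  = refl
subT-subT σ τ e        = refl
subT-subT σ τ c0       = refl
subT-subT σ τ c1       = refl
subT-subT σ τ (s ∘ₜ t) = cong₂ _∘ₜ_ (subT-subT σ τ s) (subT-subT σ τ t)

extS-subT : (σ : Sub n m) (τ : Sub m k) → subT (extS τ) ∘ extS σ ≗ extS (subT τ ∘ σ)
extS-subT σ τ zero    = refl
extS-subT σ τ (suc i) = trans (subT-renT suc (extS τ) (σ i)) (sym (renT-subT τ suc (σ i)))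

subF-subF : (σ : Sub n m) (τ : Sub m k) → ∀ φ → subF τ (subF σ φ) ≡ subF (subT τ ∘ σ) φ
subF-subF σ τ (s ≼ t)  = cong₂ _≼_ (subT-subT σ τ s) (subT-subT σ τ t)
subF-subF σ τ (s ≐ t)  = cong₂ _≐_ (subT-subT σ τ s) (subT-subT σ τ t)
subF-subF σ τ ⊥'       = refl
subF-subF σ τ (φ ⇒ ψ)  = cong₂ _⇒_ (subF-subF σ τ φ) (subF-subF σ τ ψ)
subF-subF σ τ (φ ∧' ψ) = cong₂ _∧'_ (subF-subF σ τ φ) (subF-subF σ τ ψ)
subF-subF σ τ (φ ∨' ψ) = cong₂ _∨'_ (subF-subF σ τ φ) (subF-subF σ τ ψ)
subF-subF σ τ (∀' φ)   = cong ∀' (trans (subF-subF (extS σ) (extS τ) φ) (subF-cong (extS-subT σ τ) φ))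
subF-subF σ τ (∃' φ)   = cong ∃' (trans (subF-subF (extS σ) (extS τ) φ) (subF-cong (extS-subT σ τ) φ))

subT-var : ∀ (t : Term n) → subT var t ≡ t
subT-var (var i)  = refl
subT-var e        = refl
subT-var c0       = refl
subT-var c1       = refl
subT-var (s ∘ₜ t) = cong₂ _∘ₜ_ (subT-var s) (subT-var t)

extS-var : extS {n} var ≗ var
extS-var zero    = refl
extS-var (suc i) = refl

subF-var : ∀ (φ : Formula n) → subF var φ ≡ φ
subF-var (s ≼ t)  = cong₂ _≼_ (subT-var s) (subT-var t)
subF-var (s ≐ t)  = cong₂ _≐_ (subT-var s) (subT-var t)
subF-var ⊥'       = refl
subF-var (φ ⇒ ψ)  = cong₂ _⇒_ (subF-var φ) (subF-var ψ)
subF-var (φ ∧' ψ) = cong₂ _∧'_ (subF-var φ) (subF-var ψ)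
subF-var (φ ∨' ψ) = cong₂ _∨'_ (subF-var φ) (subF-var ψ)
subF-var (∀' φ)   = cong ∀' (trans (subF-cong extS-var φ) (subF-var φ))
subF-var (∃' φ)   = cong ∃' (trans (subF-cong extS-var φ) (subF-var φ))

subT-∷ₛ-wkT : ∀ (u t : Term n) → subT (u ∷ₛ var) (wkT t) ≡ t
subT-∷ₛ-wkT u t = trans (subT-renT suc (u ∷ₛ var) t) (subT-var t)

subF-∷ₛ-extS : (σ : Sub m n) (u : Term n) → ∀ φ → subF (u ∷ₛ var) (subF (extS σ) φ) ≡ subF (u ∷ₛ σ) φ
subF-∷ₛ-extS σ u φ = trans (subF-subF (extS σ) (u ∷ₛ var) φ) (subF-cong pointwise φ)
  where
  pointwise : subT (u ∷ₛ var) ∘ extS σ ≗ u ∷ₛ σ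
  pointwise zero    = refl
  pointwise (suc i) = subT-∷ₛ-wkT u (σ i)

[]-as-subF : ∀ (φ : Formula (suc n)) t → φ [ t ] ≡ subF (t ∷ₛ var) φ
[]-as-subF φ t = subF-cong (λ { zero → refl ; (suc i) → refl }) φ

≼𝔇-refl : ∀ a → a ≼𝔇 a
≼𝔇-refl a = [] , ++-identityʳ a

≼𝔇-[]⁻ : a ≼𝔇 [] → a ≡ []
≼𝔇-[]⁻ {a = a} (γ , aγ≡[]) = ++-conicalˡ a γ aγ≡[]

≼𝔇-∷ʳ⁺ : a ≼𝔇 b → a ≼𝔇 (b ∷ʳ x)
≼𝔇-∷ʳ⁺ {a = a} {x = x} (γ , refl) = γ ∷ʳ x , sym (++-assoc a γ (x ∷ []))

≼𝔇-∷ʳ⁻ : a ≼𝔇 (b ∷ʳ x) → a ≡ b ∷ʳ x ⊎ a ≼𝔇 b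
≼𝔇-∷ʳ⁻ {a = a} {b = b} (γ , aγ≡bx) with reverseView γ
... | []           = inj₁ (trans (sym (++-identityʳ a)) aγ≡bx)
... | γ′ ∶ _ ∶ʳ y  = inj₂ (γ′ , ∷ʳ-injectiveˡ (a ++ γ′) b (trans (++-assoc a γ′ (y ∷ [])) aγ≡bx))

infix 2 _⊩_
_⊩_ : List (Formula n) → Formula n → Set
Γ ⊩ φ = Γ ⊢[ DAxiom ] φ

weaken : ∀ {Γ Δ : List (Formula n)} → Γ ⊆ Δ → Γ ⊩ φ → Δ ⊩ φ
weaken Γ⊆Δ (hyp φ∈Γ)        = hyp (Γ⊆Δ φ∈Γ)
weaken Γ⊆Δ (axT ax)         = axT ax
weaken Γ⊆Δ (⊥E d)           = ⊥E (weaken Γ⊆Δ d)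
weaken Γ⊆Δ (raa d)          = raa (weaken (∷⁺ʳ _ Γ⊆Δ) d)
weaken Γ⊆Δ (⇒I d)           = ⇒I (weaken (∷⁺ʳ _ Γ⊆Δ) d)
weaken Γ⊆Δ (⇒E d d′)        = ⇒E (weaken Γ⊆Δ d) (weaken Γ⊆Δ d′)
weaken Γ⊆Δ (∧I d d′)        = ∧I (weaken Γ⊆Δ d) (weaken Γ⊆Δ d′)
weaken Γ⊆Δ (∧E₁ d)          = ∧E₁ (weaken Γ⊆Δ d)
weaken Γ⊆Δ (∧E₂ d)          = ∧E₂ (weaken Γ⊆Δ d)
weaken Γ⊆Δ (∨I₁ d)          = ∨I₁ (weaken Γ⊆Δ d)
weaken Γ⊆Δ (∨I₂ d)          = ∨I₂ (weaken Γ⊆Δ d)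
weaken Γ⊆Δ (∨E d d₁ d₂)     = ∨E (weaken Γ⊆Δ d) (weaken (∷⁺ʳ _ Γ⊆Δ) d₁) (weaken (∷⁺ʳ _ Γ⊆Δ) d₂)
weaken Γ⊆Δ (∀I d)           = ∀I (weaken (map⁺ wkF Γ⊆Δ) d)
weaken Γ⊆Δ (∀E d t)         = ∀E (weaken Γ⊆Δ d) t
weaken Γ⊆Δ (∃I t d)         = ∃I t (weaken Γ⊆Δ d)
weaken Γ⊆Δ (∃E d d′)        = ∃E (weaken Γ⊆Δ d) (weaken (∷⁺ʳ _ (map⁺ wkF Γ⊆Δ)) d′)
weaken Γ⊆Δ ≐refl            = ≐refl
weaken Γ⊆Δ (≐subst χ d d′)  = ≐subst χ (weaken Γ⊆Δ d) (weaken Γ⊆Δ d′)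

weaken₁ : Γ ⊩ φ → ψ ∷ Γ ⊩ φ
weaken₁ = weaken (xs⊆x∷xs _ _)

⇔E₁ : Γ ⊩ φ ⇔ ψ → Γ ⊩ φ → Γ ⊩ ψ
⇔E₁ φ⇔ψ = ⇒E (∧E₁ φ⇔ψ)

⇔E₂ : Γ ⊩ φ ⇔ ψ → Γ ⊩ ψ → Γ ⊩ φ
⇔E₂ φ⇔ψ = ⇒E (∧E₂ φ⇔ψ)

∀E₁ : ∀ {φ : Formula (suc n)} → Γ ⊩ ∀' φ → ∀ t → Γ ⊩ subF (t ∷ₛ var) φ
∀E₁ {Γ = Γ} {φ = φ} d t = subst (Γ ⊩_) ([]-as-subF φ t) (∀E d t)

∀E₂ : ∀ {φ : Formula (suc (suc n))} → Γ ⊩ ∀' (∀' φ) → ∀ s t → Γ ⊩ subF (t ∷ₛ s ∷ₛ var) φ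
∀E₂ {Γ = Γ} {φ = φ} d s t = subst (Γ ⊩_) (subF-∷ₛ-extS (s ∷ₛ var) t φ) (∀E₁ (∀E₁ d s) t)

∀E₃ : ∀ {φ : Formula (suc (suc (suc n)))} → Γ ⊩ ∀' (∀' (∀' φ)) → ∀ s t u → Γ ⊩ subF (u ∷ₛ t ∷ₛ s ∷ₛ var) φ
∀E₃ {Γ = Γ} {φ = φ} d s t u = subst (Γ ⊩_) (subF-∷ₛ-extS (t ∷ₛ s ∷ₛ var) u φ) (∀E₁ (∀E₂ d s t) u)

≐-rewrite : ∀ (χ : Formula (suc n)) {A B} → subF (s ∷ₛ var) χ ≡ A → subF (t ∷ₛ var) χ ≡ B →
            Γ ⊩ s ≐ t → Γ ⊩ A → Γ ⊩ B
≐-rewrite {s = s} {t = t} {Γ = Γ} χ refl refl s≐t =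
  subst (Γ ⊩_) ([]-as-subF χ t) ∘ ≐subst χ s≐t ∘ subst (Γ ⊩_) (sym ([]-as-subF χ s))

≐-sym : Γ ⊩ s ≐ t → Γ ⊩ t ≐ s
≐-sym {s = s} {t = t} s≐t =
  ≐-rewrite (var zero ≐ wkT s) (cong (s ≐_) (subT-∷ₛ-wkT s s)) (cong (t ≐_) (subT-∷ₛ-wkT t s)) s≐t ≐refl

≐-trans : Γ ⊩ s ≐ t → Γ ⊩ t ≐ u → Γ ⊩ s ≐ u
≐-trans {s = s} {t = t} {u = u} s≐t t≐u =
  ≐-rewrite (wkT s ≐ var zero) (cong (_≐ t) (subT-∷ₛ-wkT t s)) (cong (_≐ u) (subT-∷ₛ-wkT u s)) t≐u s≐t

∘-congˡ : Γ ⊩ s ≐ s′ → Γ ⊩ s ∘ₜ t ≐ s′ ∘ₜ t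
∘-congˡ {s = s} {s′ = s′} {t = t} s≐s′ =
  ≐-rewrite (wkT s ∘ₜ wkT t ≐ var zero ∘ₜ wkT t)
    (cong₂ (λ X Y → X ∘ₜ Y ≐ s ∘ₜ Y) (subT-∷ₛ-wkT s s) (subT-∷ₛ-wkT s t))
    (cong₂ (λ X Y → X ∘ₜ Y ≐ s′ ∘ₜ Y) (subT-∷ₛ-wkT s′ s) (subT-∷ₛ-wkT s′ t)) s≐s′ ≐refl

∘-congʳ : Γ ⊩ t ≐ t′ → Γ ⊩ s ∘ₜ t ≐ s ∘ₜ t′
∘-congʳ {t = t} {t′ = t′} {s = s} t≐t′ =
  ≐-rewrite (wkT s ∘ₜ wkT t ≐ wkT s ∘ₜ var zero)
    (cong₂ (λ X Y → X ∘ₜ Y ≐ X ∘ₜ t) (subT-∷ₛ-wkT t s) (subT-∷ₛ-wkT t t))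
    (cong₂ (λ X Y → X ∘ₜ Y ≐ X ∘ₜ t′) (subT-∷ₛ-wkT t′ s) (subT-∷ₛ-wkT t′ t)) t≐t′ ≐refl

∘-cong : Γ ⊩ s ≐ s′ → Γ ⊩ t ≐ t′ → Γ ⊩ s ∘ₜ t ≐ s′ ∘ₜ t′
∘-cong s≐s′ t≐t′ = ≐-trans (∘-congˡ s≐s′) (∘-congʳ t≐t′)

≼-resp : Γ ⊩ s ≐ s′ → Γ ⊩ t ≐ t′ → Γ ⊩ s ≼ t → Γ ⊩ s′ ≼ t′
≼-resp {s = s} {s′ = s′} {t = t} {t′ = t′} s≐s′ t≐t′ =
  ≐-rewrite (wkT s′ ≼ var zero) (cong (_≼ t) (subT-∷ₛ-wkT t s′)) (cong (_≼ t′) (subT-∷ₛ-wkT t′ s′)) t≐t′ ∘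
  ≐-rewrite (var zero ≼ wkT t) (cong (s ≼_) (subT-∷ₛ-wkT s t)) (cong (s′ ≼_) (subT-∷ₛ-wkT s′ t)) s≐s′

≐-resp : Γ ⊩ s ≐ s′ → Γ ⊩ t ≐ t′ → Γ ⊩ s ≐ t → Γ ⊩ s′ ≐ t′
≐-resp s≐s′ t≐t′ s≐t = ≐-trans (≐-sym s≐s′) (≐-trans s≐t t≐t′)

¬≼-resp : Γ ⊩ s ≐ s′ → Γ ⊩ t ≐ t′ → Γ ⊩ ¬' (s ≼ t) → Γ ⊩ ¬' (s′ ≼ t′)
¬≼-resp s≐s′ t≐t′ s⋠t =
  ⇒I (⇒E (weaken₁ s⋠t) (≼-resp (≐-sym (weaken₁ s≐s′)) (≐-sym (weaken₁ t≐t′)) (hyp (here refl))))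

¬≐-resp : Γ ⊩ s ≐ s′ → Γ ⊩ t ≐ t′ → Γ ⊩ ¬' (s ≐ t) → Γ ⊩ ¬' (s′ ≐ t′)
¬≐-resp s≐s′ t≐t′ s≢t =
  ⇒I (⇒E (weaken₁ s≢t) (≐-resp (≐-sym (weaken₁ s≐s′)) (≐-sym (weaken₁ t≐t′)) (hyp (here refl))))

¬≐-sym : Γ ⊩ ¬' (s ≐ t) → Γ ⊩ ¬' (t ≐ s)
¬≐-sym s≢t = ⇒I (⇒E (weaken₁ s≢t) (≐-sym (hyp (here refl))))

bit : Bool → Term n
bit false = c0
bit true  = c1

ax-identityˡ : ∀ s → Γ ⊩ s ≐ e ∘ₜ s
ax-identityˡ s = ∧E₁ (∀E (axT d1) s)

ax-identityʳ : ∀ s → Γ ⊩ s ≐ s ∘ₜ e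
ax-identityʳ s = ∧E₂ (∀E (axT d1) s)

ax-assoc : ∀ s t u → Γ ⊩ (s ∘ₜ t) ∘ₜ u ≐ s ∘ₜ (t ∘ₜ u)
ax-assoc = ∀E₃ (axT d2)

ax-∘bit-injective : ∀ x → Γ ⊩ ¬' (s ≐ t) → Γ ⊩ ¬' (s ∘ₜ bit x ≐ t ∘ₜ bit x)
ax-∘bit-injective {s = s} {t = t} false s≢t = ∧E₁ (⇒E (∀E₂ (axT d3) s t) s≢t)
ax-∘bit-injective {s = s} {t = t} true  s≢t = ∧E₂ (⇒E (∀E₂ (axT d3) s t) s≢t)

ax-0≢1 : ∀ s t → Γ ⊩ ¬' (s ∘ₜ c0 ≐ t ∘ₜ c1)
ax-0≢1 = ∀E₂ (axT d4)

ax-≼e : ∀ s → Γ ⊩ (s ≼ e) ⇔ (s ≐ e)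
ax-≼e s = ∀E (axT d5) s

ax-≼∘bit : ∀ x s t → Γ ⊩ (s ≼ t ∘ₜ bit x) ⇔ ((s ≐ t ∘ₜ bit x) ∨' (s ≼ t))
ax-≼∘bit false = ∀E₂ (axT d6)
ax-≼∘bit true  = ∀E₂ (axT d7)

bit≢e : ∀ x → Γ ⊩ ¬' (bit x ≐ e)
bit≢e false = ⇒I (⇒E (ax-0≢1 c1 e)
  (≐-trans (∘-congʳ (hyp (here refl))) (≐-trans (≐-sym (ax-identityʳ c1)) (ax-identityˡ c1))))
bit≢e true = ⇒I (⇒E (ax-0≢1 e c0)
  (≐-trans (≐-sym (ax-identityˡ c0)) (≐-trans (ax-identityʳ c0) (∘-congʳ (≐-sym (hyp (here refl)))))))

e≢∘bit : Γ ⊩ t ≼ t → Γ ⊩ ¬' (e ≐ t ∘ₜ bit x)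
e≢∘bit {Γ = Γ} {t = t} {x = x} t≼t = ⇒I (⇒E (bit≢e x) bit≐e)
  where
  Δ = e ≐ t ∘ₜ bit x ∷ Γ
  t≼e : Δ ⊩ t ≼ e
  t≼e = ≼-resp ≐refl (≐-sym (hyp (here refl))) (⇔E₂ (ax-≼∘bit x t t) (∨I₂ (weaken₁ t≼t)))
  bit≐e : Δ ⊩ bit x ≐ e
  bit≐e = ≐-trans (ax-identityˡ (bit x))
            (≐-trans (∘-congˡ (≐-sym (⇔E₁ (ax-≼e t) t≼e))) (≐-sym (hyp (here refl))))

∘bit≢∘bit : ∀ x y → (x ≡ y → Γ ⊩ ¬' (s ≐ t)) → Γ ⊩ ¬' (s ∘ₜ bit x ≐ t ∘ₜ bit y)
∘bit≢∘bit false false s≢t = ax-∘bit-injective false (s≢t refl)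
∘bit≢∘bit true  true  s≢t = ax-∘bit-injective true (s≢t refl)
∘bit≢∘bit false true  _   = ax-0≢1 _ _
∘bit≢∘bit true  false _   = ¬≐-sym (ax-0≢1 _ _)

_∘bit_ : Term n → Bool → Term n
t ∘bit x = t ∘ₜ bit x

-- Nested to the left, (⋯(e b₁)⋯)bₙ, so that axioms (6) and (7) peel off the last bit.
num : BitString → Term n
num b = foldl _∘bit_ e b

num-∷ʳ : ∀ b x → num {n} (b ∷ʳ x) ≡ num b ∘ₜ bit x
num-∷ʳ b x = foldl-∷ʳ _∘bit_ e x b

renT-num : (ρ : Ren n m) → ∀ b → renT ρ (num b) ≡ num b
renT-num ρ = renT-foldl e
  where
  renT-bit : ∀ x → renT ρ (bit x) ≡ bit x
  renT-bit false = refl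
  renT-bit true  = refl
  renT-foldl : ∀ t b → renT ρ (foldl _∘bit_ t b) ≡ foldl _∘bit_ (renT ρ t) b
  renT-foldl t []      = refl
  renT-foldl t (x ∷ b) = trans (renT-foldl (t ∘bit x) b) (cong (λ u → foldl _∘bit_ (renT ρ t ∘ₜ u) b) (renT-bit x))

≐-num-∷ʳ : ∀ b x → Γ ⊩ num (b ∷ʳ x) ≐ num b ∘ₜ bit x
≐-num-∷ʳ {Γ = Γ} b x = subst (λ u → Γ ⊩ num (b ∷ʳ x) ≐ u) (num-∷ʳ b x) ≐refl

≼-num-refl : ∀ b → Γ ⊩ num b ≼ num b
≼-num-refl b with reverseView b
... | []          = ⇔E₂ (ax-≼e e) ≐refl
... | b′ ∶ _ ∶ʳ x = ≼-resp (≐-sym (≐-num-∷ʳ b′ x)) (≐-sym (≐-num-∷ʳ b′ x)) (⇔E₂ (ax-≼∘bit x _ _) (∨I₁ ≐refl))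

≼-num⁺ : a ≼𝔇 b → Γ ⊩ num a ≼ num b
≼-num⁺ = go (reverseView _)
  where
  go : Reverse b → a ≼𝔇 b → Γ ⊩ num a ≼ num b
  go [] a≼[] rewrite ≼𝔇-[]⁻ a≼[] = ≼-num-refl []
  go (b ∶ r ∶ʳ x) a≼bx with ≼𝔇-∷ʳ⁻ a≼bx
  ... | inj₁ refl = ≼-num-refl (b ∷ʳ x)
  ... | inj₂ a≼b  = ≼-resp ≐refl (≐-sym (≐-num-∷ʳ b x)) (⇔E₂ (ax-≼∘bit x _ _) (∨I₂ (go r a≼b)))

≐-num⁺ : a ≡ b → Γ ⊩ num a ≐ num b
≐-num⁺ refl = ≐refl

≢-num⁺ : ¬ a ≡ b → Γ ⊩ ¬' (num a ≐ num b)
≢-num⁺ = go (reverseView _) (reverseView _)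
  where
  go : Reverse a → Reverse b → ¬ a ≡ b → Γ ⊩ ¬' (num a ≐ num b)
  go [] [] a≢b = ⊥-elim (a≢b refl)
  go [] (b ∶ _ ∶ʳ y) _ = ¬≐-resp ≐refl (≐-sym (≐-num-∷ʳ b y)) (e≢∘bit (≼-num-refl b))
  go (a ∶ _ ∶ʳ x) [] _ = ¬≐-resp (≐-sym (≐-num-∷ʳ a x)) ≐refl (¬≐-sym (e≢∘bit (≼-num-refl a)))
  go (a ∶ r ∶ʳ x) (b ∶ r′ ∶ʳ y) ax≢by =
    ¬≐-resp (≐-sym (≐-num-∷ʳ a x)) (≐-sym (≐-num-∷ʳ b y))
      (∘bit≢∘bit x y λ { refl → go r r′ (ax≢by ∘ cong (_∷ʳ x)) })

⋠-num⁺ : ¬ a ≼𝔇 b → Γ ⊩ ¬' (num a ≼ num b)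
⋠-num⁺ = go (reverseView _)
  where
  go : Reverse b → ¬ a ≼𝔇 b → Γ ⊩ ¬' (num a ≼ num b)
  go {a = a} [] a⋠[] =
    ⇒I (⇒E (≢-num⁺ {a = a} {b = []} λ { refl → a⋠[] (≼𝔇-refl []) }) (⇔E₁ (ax-≼e _) (hyp (here refl))))
  go {a = a} (b ∶ r ∶ʳ x) a⋠bx =
    ¬≼-resp ≐refl (≐-sym (≐-num-∷ʳ b x)) (⇒I (∨E (⇔E₁ (ax-≼∘bit x _ _) (hyp (here refl)))
      (⇒E (¬≐-resp ≐refl (≐-num-∷ʳ b x) (≢-num⁺ {a = a} {b = b ∷ʳ x} λ { refl → a⋠bx (≼𝔇-refl _) }))
          (hyp (here refl)))
      (⇒E (go r (a⋠bx ∘ ≼𝔇-∷ʳ⁺)) (hyp (here refl)))))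

≼-num-elim : ∀ (χ : Formula (suc n)) → Γ ⊩ s ≼ num b → (∀ a → a ≼𝔇 b → Γ ⊩ χ [ num a ]) → Γ ⊩ χ [ s ]
≼-num-elim χ = go (reverseView _)
  where
  go : Reverse b → Γ ⊩ s ≼ num b → (∀ a → a ≼𝔇 b → Γ ⊩ χ [ num a ]) → Γ ⊩ χ [ s ]
  go [] s≼e prefix = ≐subst χ (≐-sym (⇔E₁ (ax-≼e _) s≼e)) (prefix [] (≼𝔇-refl []))
  go (b ∶ r ∶ʳ x) s≼bx prefix = ∨E
    (⇔E₁ (ax-≼∘bit x _ _) (≼-resp ≐refl (≐-num-∷ʳ b x) s≼bx))
    (≐subst χ (≐-trans (≐-num-∷ʳ b x) (≐-sym (hyp (here refl)))) (weaken₁ (prefix (b ∷ʳ x) (≼𝔇-refl _))))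
    (go r (hyp (here refl)) λ a a≼b → weaken₁ (prefix a (≼𝔇-∷ʳ⁺ a≼b)))

num-++ : ∀ a b → Γ ⊩ num a ∘ₜ num b ≐ num (a ++ b)
num-++ a b = go (reverseView b)
  where
  go : ∀ {b} → Reverse b → Γ ⊩ num a ∘ₜ num b ≐ num (a ++ b)
  go [] rewrite ++-identityʳ a = ≐-sym (ax-identityʳ (num a))
  go (b ∶ r ∶ʳ x) rewrite sym (++-assoc a b (x ∷ [])) =
    ≐-resp (∘-congʳ (≐-sym (≐-num-∷ʳ b x))) (≐-sym (≐-num-∷ʳ (a ++ b) x))
      (≐-trans (≐-sym (ax-assoc _ _ _)) (∘-congˡ (go r)))

⟦wkT⟧ₜ : ∀ (t : Term n) {ρ : Env n} → ⟦ wkT t ⟧ₜ (a ∷ᵉ ρ) ≡ ⟦ t ⟧ₜ ρ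
⟦wkT⟧ₜ (var i)  = refl
⟦wkT⟧ₜ e        = refl
⟦wkT⟧ₜ c0       = refl
⟦wkT⟧ₜ c1       = refl
⟦wkT⟧ₜ (s ∘ₜ t) = cong₂ _++_ (⟦wkT⟧ₜ s) (⟦wkT⟧ₜ t)

numₛ : Env m → Sub m n
numₛ ρ i = num (ρ i)

num-eval : ∀ (t : Term m) (ρ : Env m) → Γ ⊩ num (⟦ t ⟧ₜ ρ) ≐ subT (numₛ ρ) t
num-eval (var i)  ρ = ≐refl
num-eval e        ρ = ≐refl
num-eval c0       ρ = ≐-sym (ax-identityˡ c0)
num-eval c1       ρ = ≐-sym (ax-identityˡ c1)
num-eval (s ∘ₜ t) ρ = ≐-trans (≐-sym (num-++ (⟦ s ⟧ₜ ρ) (⟦ t ⟧ₜ ρ))) (∘-cong (num-eval s ρ) (num-eval t ρ))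

subF-extS-numₛ-num : ∀ (φ : Formula (suc m)) (ρ : Env m) a →
                     subF (extS (numₛ ρ)) φ [ num {n} a ] ≡ subF (numₛ (a ∷ᵉ ρ)) φ
subF-extS-numₛ-num φ ρ a = begin
  subF (extS (numₛ ρ)) φ [ num a ]              ≡⟨ []-as-subF _ (num a) ⟩
  subF (num a ∷ₛ var) (subF (extS (numₛ ρ)) φ)  ≡⟨ subF-∷ₛ-extS (numₛ ρ) (num a) φ ⟩
  subF (num a ∷ₛ numₛ ρ) φ                      ≡⟨ subF-cong (λ { zero → refl ; (suc i) → refl }) φ ⟩
  subF (numₛ (a ∷ᵉ ρ)) φ                        ∎
  where open ≡-Reasoning

subF-extS-numₛ-var : ∀ (φ : Formula (suc m)) (ρ : Env m) →
                     subF (extS (numₛ ρ)) φ [ var zero ] ≡ subF (extS (numₛ {n = n} ρ)) φ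
subF-extS-numₛ-var φ ρ = begin
  subF (extS (numₛ ρ)) φ [ var zero ]              ≡⟨ []-as-subF _ (var zero) ⟩
  subF (var zero ∷ₛ var) (subF (extS (numₛ ρ)) φ)  ≡⟨ subF-∷ₛ-extS (numₛ ρ) (var zero) φ ⟩
  subF (var zero ∷ₛ numₛ ρ) φ                      ≡⟨ subF-cong pointwise φ ⟩
  subF (extS (numₛ ρ)) φ                           ∎
  where
  open ≡-Reasoning
  pointwise : var zero ∷ₛ numₛ ρ ≗ extS (numₛ ρ)
  pointwise zero    = refl
  pointwise (suc i) = sym (renT-num suc (ρ i))

∃I-num : ∀ (φ : Formula (suc m)) {ρ : Env m} a → Γ ⊩ subF (numₛ (a ∷ᵉ ρ)) φ → Γ ⊩ subF (numₛ ρ) (∃' φ)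
∃I-num {Γ = Γ} φ a d = ∃I (num a) (subst (Γ ⊩_) (sym (subF-extS-numₛ-num φ _ a)) d)

≼-complete : ∀ s t (ρ : Env m) → ⟦ s ≼ t ⟧ ρ → Γ ⊩ subF (numₛ ρ) (s ≼ t)
≼-complete s t ρ s≼t = ≼-resp (num-eval s ρ) (num-eval t ρ) (≼-num⁺ s≼t)

Σ-complete : IsΣ φ → (ρ : Env m) → ⟦ φ ⟧ ρ → Γ ⊩ subF (numₛ ρ) φ
Σ-complete (σ≼ s t) ρ s≼t = ≼-complete s t ρ s≼t
Σ-complete (σ¬≼ s t) ρ s⋠t = ¬≼-resp (num-eval s ρ) (num-eval t ρ) (⋠-num⁺ s⋠t)
Σ-complete (σ≐ s t) ρ s≡t = ≐-resp (num-eval s ρ) (num-eval t ρ) (≐-num⁺ s≡t)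
Σ-complete (σ¬≐ s t) ρ s≢t = ¬≐-resp (num-eval s ρ) (num-eval t ρ) (≢-num⁺ s≢t)
Σ-complete (σ∧ φ-Σ ψ-Σ) ρ (⊨φ , ⊨ψ) = ∧I (Σ-complete φ-Σ ρ ⊨φ) (Σ-complete ψ-Σ ρ ⊨ψ)
Σ-complete (σ∨ φ-Σ ψ-Σ) ρ (inj₁ ⊨φ) = ∨I₁ (Σ-complete φ-Σ ρ ⊨φ)
Σ-complete (σ∨ φ-Σ ψ-Σ) ρ (inj₂ ⊨ψ) = ∨I₂ (Σ-complete ψ-Σ ρ ⊨ψ)
Σ-complete (σ∃ {φ} φ-Σ) ρ (a , ⊨φ) = ∃I-num φ a (Σ-complete φ-Σ (a ∷ᵉ ρ) ⊨φ)
Σ-complete (σ∃≼ t {φ} φ-Σ) ρ (a , a≼t , ⊨φ) =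
  ∃I-num (var zero ≼ wkT t ∧' φ) a (∧I (≼-complete (var zero) (wkT t) (a ∷ᵉ ρ) a≼t) (Σ-complete φ-Σ (a ∷ᵉ ρ) ⊨φ))
Σ-complete {Γ = Γ} (σ∀≼ t {φ} φ-Σ) ρ ⊨∀≼ =
  ∀I (⇒I (subst (Δ ⊩_) (subF-extS-numₛ-var φ ρ) (≼-num-elim (subF (extS (numₛ ρ)) φ) x≼t prefix)))
  where
  Δ = var zero ≼ subT (extS (numₛ ρ)) (wkT t) ∷ map wkF Γ
  bound≡ : subT (extS (numₛ ρ)) (wkT t) ≡ subT (numₛ ρ) t
  bound≡ = trans (subT-renT suc _ t) (subT-cong (renT-num suc ∘ ρ) t)
  x≼t : Δ ⊩ var zero ≼ num (⟦ t ⟧ₜ ρ)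
  x≼t = ≼-resp ≐refl (≐-sym (num-eval t ρ)) (subst (λ u → Δ ⊩ var zero ≼ u) bound≡ (hyp (here refl)))
  prefix : ∀ a → a ≼𝔇 ⟦ t ⟧ₜ ρ → Δ ⊩ subF (extS (numₛ ρ)) φ [ num a ]
  prefix a a≼t = subst (Δ ⊩_) (sym (subF-extS-numₛ-num φ ρ a))
                   (Σ-complete φ-Σ (a ∷ᵉ ρ) (⊨∀≼ a (subst (a ≼𝔇_) (sym (⟦wkT⟧ₜ t)) a≼t)))

theorem5 : (φ : Sentence) → IsΣ φ → 𝔇⊨ φ → D⊢ φ
theorem5 φ φ-Σ 𝔇⊨φ = subst ([] ⊩_) (trans (subF-cong (λ ()) φ) (subF-var φ)) (Σ-complete φ-Σ _ 𝔇⊨φ)
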